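{- Let $(T,\eta,\mu)$ be a monad on a category $\mathcal{C}$ with Eilenberg-Moore adjunction $\mathcal{F}\dashv U$, let $B$ be an endofunctor on $\mathcal{C}$ with final coalgebra $\zeta\colon\Theta\xrightarrow{\cong}B(\Theta)$, let $\kappa\colon TB\Rightarrow BT$ be an Eilenberg-Moore law with lifting $\overline{B}$, let $A$ be an endofunctor on $\mathcal{C}$ and $\rho\colon AU\Rightarrow U\overline{B}$ a natural transformation. Let $a\colon T(\Theta)\to\Theta$ be the unique map with $\zeta\circ a=B(a)\circ\kappa_\Theta\circ T(\zeta)$ (so $(\Theta,a)$ is an Eilenberg-Moore algebra), put $\ell_{\mathrm{em}}=\zeta^{ -1}\circ B(a)\colon BT(\Theta)\to\Theta$ and $\ell^A_{\mathrm{em}}=\zeta^{ -1}\circ B(a)\circ\kappa_\Theta\circ T(\rho_{(\Theta,a)})\colon TA(\Theta)\to\Theta$. Then $\ell^A_{\mathrm{em}}=\ell_{\mathrm{em}}\circ(\rho_2)_\Theta$.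
   Context: An Eilenberg-Moore law is a natural transformation $\kappa\colon TB\Rightarrow BT$ compatible with unit and multiplication ($\kappa\circ\eta B=B\eta$, $\kappa\circ\mu B=B\mu\circ\kappa T\circ T\kappa$); its lifting is $\overline{B}(X,b)=(B(X),B(b)\circ\kappa_X)$. $\mathcal{F}(X)=(T(X),\mu_X)$ and $U$ is the forgetful functor. The natural transformation $\rho_2\colon TA\Rightarrow BT$ (underlying the mate $\mathcal{F}A\Rightarrow\overline{B}\mathcal{F}$) has components $(\rho_2)_X=B(\mu_X)\circ\kappa_{T(X)}\circ T(\rho_{(T(X),\mu_X)})\circ TA(\eta_X)$. -}

module Defs where

open import Level using (Level; suc; _⊔_)
open import Relation.Binary.PropositionalEquality
open ≡-Reasoning

record Category (o ℓ : Level) : Set (suc (o ⊔ ℓ)) where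
  infixr 9 _∘_
  field
    Obj       : Set o
    Hom       : Obj → Obj → Set ℓ
    id        : ∀ {X} → Hom X X
    _∘_       : ∀ {X Y Z} → Hom Y Z → Hom X Y → Hom X Z
    identityˡ : ∀ {X Y} {f : Hom X Y} → id ∘ f ≡ f
    identityʳ : ∀ {X Y} {f : Hom X Y} → f ∘ id ≡ f
    assoc     : ∀ {W X Y Z} {f : Hom W X} {g : Hom X Y} {h : Hom Y Z} →
                (h ∘ g) ∘ f ≡ h ∘ (g ∘ f)

module _ {o ℓ : Level} (C : Category o ℓ) where
  open Category C

  record Endofunctor : Set (o ⊔ ℓ) where
    field
      F₀   : Obj → Obj
      F₁   : ∀ {X Y} → Hom X Y → Hom (F₀ X) (F₀ Y)
      F-id : ∀ {X} → F₁ (id {X}) ≡ id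
      F-∘  : ∀ {X Y Z} (g : Hom Y Z) (f : Hom X Y) → F₁ (g ∘ f) ≡ F₁ g ∘ F₁ f

  record Monad : Set (o ⊔ ℓ) where
    field
      T          : Endofunctor
    open Endofunctor T renaming (F₀ to T₀; F₁ to T₁) public
    field
      η          : ∀ X → Hom X (T₀ X)
      μ          : ∀ X → Hom (T₀ (T₀ X)) (T₀ X)
      η-natural  : ∀ {X Y} (f : Hom X Y) → T₁ f ∘ η X ≡ η Y ∘ f
      μ-natural  : ∀ {X Y} (f : Hom X Y) → T₁ f ∘ μ X ≡ μ Y ∘ T₁ (T₁ f)
      μ-η-left   : ∀ X → μ X ∘ T₁ (η X) ≡ id
      μ-η-right  : ∀ X → μ X ∘ η (T₀ X) ≡ id
      μ-assoc    : ∀ X → μ X ∘ T₁ (μ X) ≡ μ X ∘ μ (T₀ X)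

  record FinalCoalgebra (B : Endofunctor) : Set (o ⊔ ℓ) where
    open Endofunctor B renaming (F₀ to B₀; F₁ to B₁)
    field
      Θ             : Obj
      ζ             : Hom Θ (B₀ Θ)
      ζ⁻¹           : Hom (B₀ Θ) Θ
      ζ⁻¹∘ζ         : ζ⁻¹ ∘ ζ ≡ id
      ζ∘ζ⁻¹         : ζ ∘ ζ⁻¹ ≡ id
      unfold        : ∀ {X} → Hom X (B₀ X) → Hom X Θ
      unfold-law    : ∀ {X} (c : Hom X (B₀ X)) → ζ ∘ unfold c ≡ B₁ (unfold c) ∘ c
      unfold-unique : ∀ {X} (c : Hom X (B₀ X)) (f : Hom X Θ) →
                      ζ ∘ f ≡ B₁ f ∘ c → f ≡ unfold c

  module EM (M : Monad) where
    open Monad M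

    record EMAlgebra : Set (o ⊔ ℓ) where
      field
        carrier : Obj
        action  : Hom (T₀ carrier) carrier
        act-η   : action ∘ η carrier ≡ id
        act-μ   : action ∘ μ carrier ≡ action ∘ T₁ action

    record EMHom (α β : EMAlgebra) : Set ℓ where
      field
        map      : Hom (EMAlgebra.carrier α) (EMAlgebra.carrier β)
        commutes : map ∘ EMAlgebra.action α ≡ EMAlgebra.action β ∘ T₁ map

    free : Obj → EMAlgebra
    free X = record
      { carrier = T₀ X ; action = μ X
      ; act-η = μ-η-right X ; act-μ = sym (μ-assoc X) }

    record EMLaw (B : Endofunctor) : Set (o ⊔ ℓ) where
      open Endofunctor B renaming (F₀ to B₀; F₁ to B₁)
      field
        κ       : ∀ X → Hom (T₀ (B₀ X)) (B₀ (T₀ X))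
        natural : ∀ {X Y} (f : Hom X Y) → B₁ (T₁ f) ∘ κ X ≡ κ Y ∘ T₁ (B₁ f)
        unit    : ∀ X → κ X ∘ η (B₀ X) ≡ B₁ (η X)
        mult    : ∀ X → κ X ∘ μ (B₀ X) ≡ B₁ (μ X) ∘ κ (T₀ X) ∘ T₁ (κ X)

    module Lifting {B : Endofunctor} (K : EMLaw B) where
      open Endofunctor B renaming (F₀ to B₀; F₁ to B₁; F-id to B-id; F-∘ to B-∘)
      open EMLaw K
      open Endofunctor T using () renaming (F-∘ to T-∘)

      lift : EMAlgebra → EMAlgebra
      lift α = record
        { carrier = B₀ X ; action = B₁ b ∘ κ X ; act-η = pη ; act-μ = pμ }
        where
        open EMAlgebra α renaming (carrier to X; action to b)
        pη : (B₁ b ∘ κ X) ∘ η (B₀ X) ≡ id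
        pη = begin
          (B₁ b ∘ κ X) ∘ η (B₀ X) ≡⟨ assoc ⟩
          B₁ b ∘ (κ X ∘ η (B₀ X)) ≡⟨ cong (B₁ b ∘_) (unit X) ⟩
          B₁ b ∘ B₁ (η X)         ≡⟨ sym (B-∘ b (η X)) ⟩
          B₁ (b ∘ η X)            ≡⟨ cong B₁ act-η ⟩
          B₁ id                   ≡⟨ B-id ⟩
          id ∎
        pμ : (B₁ b ∘ κ X) ∘ μ (B₀ X) ≡ (B₁ b ∘ κ X) ∘ T₁ (B₁ b ∘ κ X)
        pμ = begin
          (B₁ b ∘ κ X) ∘ μ (B₀ X)                          ≡⟨ assoc ⟩
          B₁ b ∘ (κ X ∘ μ (B₀ X))                          ≡⟨ cong (B₁ b ∘_) (mult X) ⟩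
          B₁ b ∘ (B₁ (μ X) ∘ κ (T₀ X) ∘ T₁ (κ X))          ≡⟨ sym assoc ⟩
          (B₁ b ∘ B₁ (μ X)) ∘ κ (T₀ X) ∘ T₁ (κ X)          ≡⟨ cong (_∘ (κ (T₀ X) ∘ T₁ (κ X))) (sym (B-∘ b (μ X))) ⟩
          B₁ (b ∘ μ X) ∘ κ (T₀ X) ∘ T₁ (κ X)               ≡⟨ cong (λ z → B₁ z ∘ κ (T₀ X) ∘ T₁ (κ X)) act-μ ⟩
          B₁ (b ∘ T₁ b) ∘ κ (T₀ X) ∘ T₁ (κ X)              ≡⟨ cong (_∘ (κ (T₀ X) ∘ T₁ (κ X))) (B-∘ b (T₁ b)) ⟩
          (B₁ b ∘ B₁ (T₁ b)) ∘ κ (T₀ X) ∘ T₁ (κ X)         ≡⟨ assoc ⟩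
          B₁ b ∘ B₁ (T₁ b) ∘ κ (T₀ X) ∘ T₁ (κ X)           ≡⟨ cong (B₁ b ∘_) (sym assoc) ⟩
          B₁ b ∘ (B₁ (T₁ b) ∘ κ (T₀ X)) ∘ T₁ (κ X)         ≡⟨ cong (λ z → B₁ b ∘ z ∘ T₁ (κ X)) (natural b) ⟩
          B₁ b ∘ (κ X ∘ T₁ (B₁ b)) ∘ T₁ (κ X)              ≡⟨ cong (B₁ b ∘_) assoc ⟩
          B₁ b ∘ κ X ∘ T₁ (B₁ b) ∘ T₁ (κ X)                ≡⟨ cong (λ z → B₁ b ∘ κ X ∘ z) (sym (T-∘ (B₁ b) (κ X))) ⟩
          B₁ b ∘ κ X ∘ T₁ (B₁ b ∘ κ X)                     ≡⟨ sym assoc ⟩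
          (B₁ b ∘ κ X) ∘ T₁ (B₁ b ∘ κ X) ∎

      -- A natural transformation ρ : A U ⇒ U B̄ (U B̄ acts on an algebra
      -- morphism h as B(h)).
      record LiftedNat (A : Endofunctor) : Set (o ⊔ ℓ) where
        open Endofunctor A renaming (F₀ to A₀; F₁ to A₁)
        field
          component : (α : EMAlgebra) →
                      Hom (A₀ (EMAlgebra.carrier α)) (EMAlgebra.carrier (lift α))
          natural   : (α β : EMAlgebra) (h : EMHom α β) →
                      B₁ (EMHom.map h) ∘ component α ≡ component β ∘ A₁ (EMHom.map h)

      ρ₂ : {A : Endofunctor} → LiftedNat A → ∀ X →
           Hom (T₀ (Endofunctor.F₀ A X)) (B₀ (T₀ X))
      ρ₂ {A} ρ X = B₁ (μ X) ∘ κ (T₀ X) ∘ T₁ (LiftedNat.component ρ (free X))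
                   ∘ T₁ (Endofunctor.F₁ A (η X))

      module Final (F : FinalCoalgebra B) where
        open FinalCoalgebra F

        a : Hom (T₀ Θ) Θ
        a = unfold (κ Θ ∘ T₁ ζ)

        a-law : ζ ∘ a ≡ B₁ a ∘ κ Θ ∘ T₁ ζ
        a-law = unfold-law (κ Θ ∘ T₁ ζ)

        private
          aη-coalg : ζ ∘ (a ∘ η Θ) ≡ B₁ (a ∘ η Θ) ∘ ζ
          aη-coalg = begin
            ζ ∘ (a ∘ η Θ)                  ≡⟨ sym assoc ⟩
            (ζ ∘ a) ∘ η Θ                  ≡⟨ cong (_∘ η Θ) a-law ⟩
            (B₁ a ∘ κ Θ ∘ T₁ ζ) ∘ η Θ      ≡⟨ assoc ⟩
            B₁ a ∘ (κ Θ ∘ T₁ ζ) ∘ η Θ      ≡⟨ cong (B₁ a ∘_) assoc ⟩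
            B₁ a ∘ κ Θ ∘ T₁ ζ ∘ η Θ        ≡⟨ cong (λ z → B₁ a ∘ κ Θ ∘ z) (η-natural ζ) ⟩
            B₁ a ∘ κ Θ ∘ η (B₀ Θ) ∘ ζ      ≡⟨ cong (B₁ a ∘_) (sym assoc) ⟩
            B₁ a ∘ (κ Θ ∘ η (B₀ Θ)) ∘ ζ    ≡⟨ cong (λ z → B₁ a ∘ z ∘ ζ) (unit Θ) ⟩
            B₁ a ∘ B₁ (η Θ) ∘ ζ            ≡⟨ sym assoc ⟩
            (B₁ a ∘ B₁ (η Θ)) ∘ ζ          ≡⟨ cong (_∘ ζ) (sym (B-∘ a (η Θ))) ⟩
            B₁ (a ∘ η Θ) ∘ ζ ∎

          id-coalg : ζ ∘ id ≡ B₁ id ∘ ζ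
          id-coalg = trans identityʳ (trans (sym identityˡ) (cong (_∘ ζ) (sym B-id)))

          c₂ : Hom (T₀ (T₀ Θ)) (B₀ (T₀ (T₀ Θ)))
          c₂ = κ (T₀ Θ) ∘ T₁ (κ Θ ∘ T₁ ζ)

          aμ-coalg : ζ ∘ (a ∘ μ Θ) ≡ B₁ (a ∘ μ Θ) ∘ c₂
          aμ-coalg = begin
            ζ ∘ (a ∘ μ Θ)                                   ≡⟨ sym assoc ⟩
            (ζ ∘ a) ∘ μ Θ                                   ≡⟨ cong (_∘ μ Θ) a-law ⟩
            (B₁ a ∘ κ Θ ∘ T₁ ζ) ∘ μ Θ                       ≡⟨ assoc ⟩
            B₁ a ∘ (κ Θ ∘ T₁ ζ) ∘ μ Θ                       ≡⟨ cong (B₁ a ∘_) assoc ⟩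
            B₁ a ∘ κ Θ ∘ T₁ ζ ∘ μ Θ                         ≡⟨ cong (λ z → B₁ a ∘ κ Θ ∘ z) (μ-natural ζ) ⟩
            B₁ a ∘ κ Θ ∘ μ (B₀ Θ) ∘ T₁ (T₁ ζ)               ≡⟨ cong (B₁ a ∘_) (sym assoc) ⟩
            B₁ a ∘ (κ Θ ∘ μ (B₀ Θ)) ∘ T₁ (T₁ ζ)             ≡⟨ cong (λ z → B₁ a ∘ z ∘ T₁ (T₁ ζ)) (mult Θ) ⟩
            B₁ a ∘ (B₁ (μ Θ) ∘ κ (T₀ Θ) ∘ T₁ (κ Θ)) ∘ T₁ (T₁ ζ)
                                                            ≡⟨ cong (B₁ a ∘_) assoc ⟩
            B₁ a ∘ B₁ (μ Θ) ∘ (κ (T₀ Θ) ∘ T₁ (κ Θ)) ∘ T₁ (T₁ ζ)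
                                                            ≡⟨ cong (λ z → B₁ a ∘ B₁ (μ Θ) ∘ z) assoc ⟩
            B₁ a ∘ B₁ (μ Θ) ∘ κ (T₀ Θ) ∘ T₁ (κ Θ) ∘ T₁ (T₁ ζ)
                                                            ≡⟨ cong (λ z → B₁ a ∘ B₁ (μ Θ) ∘ κ (T₀ Θ) ∘ z) (sym (T-∘ (κ Θ) (T₁ ζ))) ⟩
            B₁ a ∘ B₁ (μ Θ) ∘ c₂                            ≡⟨ sym assoc ⟩
            (B₁ a ∘ B₁ (μ Θ)) ∘ c₂                          ≡⟨ cong (_∘ c₂) (sym (B-∘ a (μ Θ))) ⟩
            B₁ (a ∘ μ Θ) ∘ c₂ ∎

          aTa-coalg : ζ ∘ (a ∘ T₁ a) ≡ B₁ (a ∘ T₁ a) ∘ c₂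
          aTa-coalg = begin
            ζ ∘ (a ∘ T₁ a)                                  ≡⟨ sym assoc ⟩
            (ζ ∘ a) ∘ T₁ a                                  ≡⟨ cong (_∘ T₁ a) a-law ⟩
            (B₁ a ∘ κ Θ ∘ T₁ ζ) ∘ T₁ a                      ≡⟨ assoc ⟩
            B₁ a ∘ (κ Θ ∘ T₁ ζ) ∘ T₁ a                      ≡⟨ cong (B₁ a ∘_) assoc ⟩
            B₁ a ∘ κ Θ ∘ T₁ ζ ∘ T₁ a                        ≡⟨ cong (λ z → B₁ a ∘ κ Θ ∘ z) (sym (T-∘ ζ a)) ⟩
            B₁ a ∘ κ Θ ∘ T₁ (ζ ∘ a)                         ≡⟨ cong (λ z → B₁ a ∘ κ Θ ∘ T₁ z) a-law ⟩
            B₁ a ∘ κ Θ ∘ T₁ (B₁ a ∘ κ Θ ∘ T₁ ζ)             ≡⟨ cong (λ z → B₁ a ∘ κ Θ ∘ z) (T-∘ (B₁ a) (κ Θ ∘ T₁ ζ)) ⟩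
            B₁ a ∘ κ Θ ∘ T₁ (B₁ a) ∘ T₁ (κ Θ ∘ T₁ ζ)        ≡⟨ cong (B₁ a ∘_) (sym assoc) ⟩
            B₁ a ∘ (κ Θ ∘ T₁ (B₁ a)) ∘ T₁ (κ Θ ∘ T₁ ζ)      ≡⟨ cong (λ z → B₁ a ∘ z ∘ T₁ (κ Θ ∘ T₁ ζ)) (sym (natural a)) ⟩
            B₁ a ∘ (B₁ (T₁ a) ∘ κ (T₀ Θ)) ∘ T₁ (κ Θ ∘ T₁ ζ) ≡⟨ cong (B₁ a ∘_) assoc ⟩
            B₁ a ∘ B₁ (T₁ a) ∘ c₂                           ≡⟨ sym assoc ⟩
            (B₁ a ∘ B₁ (T₁ a)) ∘ c₂                         ≡⟨ cong (_∘ c₂) (sym (B-∘ a (T₁ a))) ⟩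
            B₁ (a ∘ T₁ a) ∘ c₂ ∎

        ΘAlg : EMAlgebra
        ΘAlg = record
          { carrier = Θ ; action = a
          ; act-η = trans (unfold-unique ζ (a ∘ η Θ) aη-coalg)
                          (sym (unfold-unique ζ id id-coalg))
          ; act-μ = trans (unfold-unique c₂ (a ∘ μ Θ) aμ-coalg)
                          (sym (unfold-unique c₂ (a ∘ T₁ a) aTa-coalg)) }

        ℓem : Hom (B₀ (T₀ Θ)) Θ
        ℓem = ζ⁻¹ ∘ B₁ a

        ℓAem : {A : Endofunctor} → LiftedNat A →
               Hom (T₀ (Endofunctor.F₀ A Θ)) Θ
        ℓAem ρ = ζ⁻¹ ∘ B₁ a ∘ κ Θ ∘ T₁ (LiftedNat.component ρ ΘAlg)

-- The action a : TΘ → Θ is an Eilenberg–Moore algebra, so it is an algebra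
-- morphism 𝓕Θ → (Θ, a) (the counit of 𝓕 ⊣ U).  Naturality of ρ along this
-- morphism, the fact that B̄ maps it to an algebra morphism, and a ∘ η = id
-- give B(a) ∘ (ρ₂)_Θ = B(a) ∘ κ_Θ ∘ T(ρ_{(Θ,a)}); composing with ζ⁻¹ yields
-- the theorem.
module Submission where

open import Defs
open import Level using (Level)
open import Relation.Binary.PropositionalEquality using (_≡_; sym; trans; cong)
open import Relation.Binary.PropositionalEquality.Properties using (module ≡-Reasoning)

module _ {o ℓ : Level} {C : Category o ℓ} {M : Monad C} where
  open Category C
  open Monad M
  open EM C M
  open Endofunctor T using () renaming (F-∘ to T-∘)

  counit : (α : EMAlgebra) → EMHom (free (EMAlgebra.carrier α)) α
  counit α = record { map = action ; commutes = act-μ }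
    where open EMAlgebra α

  module _ {B : Endofunctor C} (K : EMLaw B) where
    open Endofunctor B renaming (F₀ to B₀; F₁ to B₁; F-∘ to B-∘)
    open EMLaw K renaming (natural to κ-natural)
    open Lifting K
    open ≡-Reasoning

    lift-hom : {α β : EMAlgebra} → EMHom α β → EMHom (lift α) (lift β)
    lift-hom {α} {β} h = record { map = B₁ f ; commutes = B-f-commutes }
      where
      open EMAlgebra α renaming (carrier to X; action to x)
      open EMAlgebra β renaming (carrier to Y; action to y)
      open EMHom h renaming (map to f)
      B-f-commutes : B₁ f ∘ (B₁ x ∘ κ X) ≡ (B₁ y ∘ κ Y) ∘ T₁ (B₁ f)
      B-f-commutes = begin
        B₁ f ∘ (B₁ x ∘ κ X)        ≡⟨ sym assoc ⟩
        (B₁ f ∘ B₁ x) ∘ κ X        ≡⟨ cong (_∘ κ X) (sym (B-∘ f x)) ⟩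
        B₁ (f ∘ x) ∘ κ X           ≡⟨ cong (λ g → B₁ g ∘ κ X) commutes ⟩
        B₁ (y ∘ T₁ f) ∘ κ X        ≡⟨ cong (_∘ κ X) (B-∘ y (T₁ f)) ⟩
        (B₁ y ∘ B₁ (T₁ f)) ∘ κ X   ≡⟨ assoc ⟩
        B₁ y ∘ (B₁ (T₁ f) ∘ κ X)   ≡⟨ cong (B₁ y ∘_) (κ-natural f) ⟩
        B₁ y ∘ (κ Y ∘ T₁ (B₁ f))   ≡⟨ sym assoc ⟩
        (B₁ y ∘ κ Y) ∘ T₁ (B₁ f)   ∎

    module _ {A : Endofunctor C} (ρ : LiftedNat A) where
      open Endofunctor A renaming (F₀ to A₀; F₁ to A₁; F-id to A-id; F-∘ to A-∘)
      open LiftedNat ρ renaming (natural to ρ-natural)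

      component-free-unit : (α : EMAlgebra) →
        let open EMAlgebra α in
        B₁ action ∘ component (free carrier) ∘ A₁ (η carrier) ≡ component α
      component-free-unit α = begin
        B₁ x ∘ component (free X) ∘ A₁ (η X)   ≡⟨ sym assoc ⟩
        (B₁ x ∘ component (free X)) ∘ A₁ (η X) ≡⟨ cong (_∘ A₁ (η X)) (ρ-natural (free X) α (counit α)) ⟩
        (component α ∘ A₁ x) ∘ A₁ (η X)        ≡⟨ assoc ⟩
        component α ∘ A₁ x ∘ A₁ (η X)          ≡⟨ cong (component α ∘_) (sym (A-∘ x (η X))) ⟩
        component α ∘ A₁ (x ∘ η X)             ≡⟨ cong (λ g → component α ∘ A₁ g) act-η ⟩
        component α ∘ A₁ id                    ≡⟨ cong (component α ∘_) A-id ⟩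
        component α ∘ id                       ≡⟨ identityʳ ⟩
        component α                            ∎
        where open EMAlgebra α renaming (carrier to X; action to x)

      B-action∘ρ₂ : (α : EMAlgebra) →
        let open EMAlgebra α in
        B₁ action ∘ ρ₂ ρ carrier ≡ B₁ action ∘ κ carrier ∘ T₁ (component α)
      B-action∘ρ₂ α = begin
        B₁ x ∘ B₁ (μ X) ∘ κ (T₀ X) ∘ ρ-unit         ≡⟨ cong (B₁ x ∘_) (sym assoc) ⟩
        B₁ x ∘ (B₁ (μ X) ∘ κ (T₀ X)) ∘ ρ-unit       ≡⟨ sym assoc ⟩
        (B₁ x ∘ B₁ (μ X) ∘ κ (T₀ X)) ∘ ρ-unit       ≡⟨ cong (_∘ ρ-unit) (EMHom.commutes (lift-hom (counit α))) ⟩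
        ((B₁ x ∘ κ X) ∘ T₁ (B₁ x)) ∘ ρ-unit         ≡⟨ assoc ⟩
        (B₁ x ∘ κ X) ∘ T₁ (B₁ x) ∘ ρ-unit           ≡⟨ cong ((B₁ x ∘ κ X) ∘_) T-unit-component ⟩
        (B₁ x ∘ κ X) ∘ T₁ (component α)             ≡⟨ assoc ⟩
        B₁ x ∘ κ X ∘ T₁ (component α)               ∎
        where
        open EMAlgebra α renaming (carrier to X; action to x)
        ρ-unit : Hom (T₀ (A₀ X)) (T₀ (B₀ (T₀ X)))
        ρ-unit = T₁ (component (free X)) ∘ T₁ (A₁ (η X))
        T-unit-component : T₁ (B₁ x) ∘ ρ-unit ≡ T₁ (component α)
        T-unit-component = begin
          T₁ (B₁ x) ∘ T₁ (component (free X)) ∘ T₁ (A₁ (η X))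
            ≡⟨ cong (T₁ (B₁ x) ∘_) (sym (T-∘ (component (free X)) (A₁ (η X)))) ⟩
          T₁ (B₁ x) ∘ T₁ (component (free X) ∘ A₁ (η X))
            ≡⟨ sym (T-∘ (B₁ x) _) ⟩
          T₁ (B₁ x ∘ component (free X) ∘ A₁ (η X))
            ≡⟨ cong T₁ (component-free-unit α) ⟩
          T₁ (component α) ∎

lemma3p8 : ∀ {o ℓ : Level} (C : Category o ℓ) (M : Monad C) (B : Endofunctor C)
             (F : FinalCoalgebra C B) (K : EM.EMLaw C M B) (A : Endofunctor C)
             (ρ : EM.Lifting.LiftedNat C M K A) →
             EM.Lifting.Final.ℓAem C M K F ρ
               ≡ Category._∘_ C (EM.Lifting.Final.ℓem C M K F)
                                (EM.Lifting.ρ₂ C M K ρ (FinalCoalgebra.Θ F))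
lemma3p8 C M B F K A ρ =
  trans (cong (ζ⁻¹ ∘_) (sym (B-action∘ρ₂ K ρ ΘAlg))) (sym assoc)
  where
  open Category C
  open FinalCoalgebra F using (ζ⁻¹)
  open EM.Lifting.Final C M K F using (ΘAlg)
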